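{- Let $G$ be a partial cube. Then ${\rm ldim}(G)\le \lceil {\rm fdim}(G)/2\rceil$.
   Context: All graphs are finite. The $d$-cube $Q_d$ has vertex set $\{0,1\}^d$, two vertices adjacent iff they differ in exactly one coordinate. A Fibonacci string is a binary string with no two consecutive $1$s; the Fibonacci cube $\Gamma_d$ is the subgraph of $Q_d$ induced by the Fibonacci strings of length $d$. An isometric embedding is an injective map preserving shortest-path distances. A partial cube is a graph that isometrically embeds into some hypercube. $\mathbb{Z}^\ell$ is regarded as the infinite graph in which two points are adjacent iff their $L_1$-distance is $1$. ${\rm fdim}(G)$ and ${\rm ldim}(G)$ are the least integers $k$ such that $G$ isometrically embeds into $\Gamma_k$, respectively $\mathbb{Z}^k$. -}

module Defs where

open import Data.Nat using (ℕ; zero; suc; _+_; _<_; _≤_)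
open import Data.Bool using (Bool; true; false)
open import Data.Integer as ℤ using (ℤ; ∣_∣; _-_)
open import Data.Vec using (Vec; []; _∷_; lookup)
open import Data.Fin using (Fin)
open import Data.Product using (Σ; ∃; _×_; _,_; proj₁)
open import Data.Empty using (⊥)
open import Relation.Nullary using (¬_)
open import Relation.Binary.PropositionalEquality using (_≡_)
open import Function.Definitions using (Injective)

record Graph : Set₁ where
  field
    V : Set
    E : V → V → Set
open Graph public

record FinGraph : Set₁ where
  field
    n     : ℕ
    adj   : Fin n → Fin n → Set
    sym   : ∀ {u v} → adj u v → adj v u
    irref : ∀ {u} → ¬ adj u u

toGraph : FinGraph → Graph
toGraph G = record { V = Fin (FinGraph.n G) ; E = FinGraph.adj G }

data Walk (G : Graph) : V G → V G → ℕ → Set where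
  nil  : ∀ {u} → Walk G u u zero
  cons : ∀ {u w v ℓ} → E G u w → Walk G w v ℓ → Walk G u v (suc ℓ)

Dist : (G : Graph) → V G → V G → ℕ → Set
Dist G u v d = Walk G u v d × (∀ ℓ → ℓ < d → ¬ Walk G u v ℓ)

IsIsometric : (G H : Graph) → (V G → V H) → Set
IsIsometric G H f =
  Injective _≡_ _≡_ f ×
  (∀ u v d → (Dist G u v d → Dist H (f u) (f v) d) × (Dist H (f u) (f v) d → Dist G u v d))

IsoEmbeds : Graph → Graph → Set
IsoEmbeds G H = Σ (V G → V H) (IsIsometric G H)

hamming : ∀ {d} → Vec Bool d → Vec Bool d → ℕ
hamming [] [] = zero
hamming (true ∷ xs) (false ∷ ys) = suc (hamming xs ys)
hamming (false ∷ xs) (true ∷ ys) = suc (hamming xs ys)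
hamming (_ ∷ xs) (_ ∷ ys) = hamming xs ys

Q : ℕ → Graph
Q d = record { V = Vec Bool d ; E = λ x y → hamming x y ≡ 1 }

data Fib : ∀ {d} → Vec Bool d → Set where
  fib[]  : Fib []
  fib1   : ∀ b → Fib (b ∷ [])
  fib0∷  : ∀ {d} {b} {xs : Vec Bool d} → Fib (b ∷ xs) → Fib (false ∷ b ∷ xs)
  fib10∷ : ∀ {d} {xs : Vec Bool d} → Fib (false ∷ xs) → Fib (true ∷ false ∷ xs)

Γ : ℕ → Graph
Γ d = record { V = Σ (Vec Bool d) Fib ; E = λ x y → hamming (proj₁ x) (proj₁ y) ≡ 1 }

L1 : ∀ {ℓ} → Vec ℤ ℓ → Vec ℤ ℓ → ℕ
L1 [] [] = zero
L1 (x ∷ xs) (y ∷ ys) = ∣ x - y ∣ + L1 xs ys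

Zℓ : ℕ → Graph
Zℓ ℓ = record { V = Vec ℤ ℓ ; E = λ x y → L1 x y ≡ 1 }

IsPartialCube : FinGraph → Set
IsPartialCube G = ∃ λ d → IsoEmbeds (toGraph G) (Q d)

IsFdim : FinGraph → ℕ → Set
IsFdim G k = IsoEmbeds (toGraph G) (Γ k) × (∀ m → IsoEmbeds (toGraph G) (Γ m) → k ≤ m)

IsLdim : FinGraph → ℕ → Set
IsLdim G k = IsoEmbeds (toGraph G) (Zℓ k) × (∀ m → IsoEmbeds (toGraph G) (Zℓ m) → k ≤ m)

module Submission where

-- It suffices to embed the Fibonacci cube Γ_d isometrically into ℤ^⌈d/2⌉:
-- composed with an optimal embedding G → Γ_f this embeds G into ℤ^⌈f/2⌉, and
-- minimality of ldim gives the bound.  The embedding cuts a Fibonacci string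
-- into blocks of two bits; no block is 11, and the admissible blocks 10, 00,
-- 01 go to -1, 0, 1, a geodesic path of ℤ, so L1 distance of the images
-- equals Hamming distance.

open import Defs
open import Data.Nat using (ℕ; _≤_; ⌈_/2⌉)
open import Data.Nat using (zero; suc; _+_; z≤n; s≤s)
import Data.Nat.Properties as ℕP
open import Data.Nat.Tactic.RingSolver as ℕSolver using ()
open import Data.Bool using (Bool; true; false; _∧_)
open import Data.Integer using (ℤ; ∣_∣; _-_; +_; -[1+_])
import Data.Integer as ℤ
import Data.Integer.Properties as ℤP
open import Data.Integer.Tactic.RingSolver as ℤSolver using ()
open import Data.Vec using (Vec; []; _∷_; _++_; map; zipWith)
open import Data.Product using (_,_; proj₁; proj₂)
open import Data.Empty using (⊥-elim)
open import Function using (_∘_)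
open import Relation.Binary.PropositionalEquality
open import Relation.Binary.Definitions using (tri<; tri≈; tri>)

mapWalk : ∀ {G H : Graph} (F : V G → V H) → (∀ {u v} → E G u v → E H (F u) (F v)) →
          ∀ {u v ℓ} → Walk G u v ℓ → Walk H (F u) (F v) ℓ
mapWalk F F-edge nil        = nil
mapWalk F F-edge (cons e w) = cons (F-edge e) (mapWalk F F-edge w)

append : ∀ {G u v w a b} → Walk G u v a → Walk G v w b → Walk G u w (a + b)
append nil        q = q
append (cons e p) q = cons e (append p q)

snoc : ∀ {G u v w a} → Walk G u v a → E G v w → Walk G u w (suc a)
snoc nil        e′ = cons e′ nil
snoc (cons e p) e′ = cons e (snoc p e′)

reverse : ∀ {G} → (∀ {u v} → E G u v → E G v u) → ∀ {u v ℓ} → Walk G u v ℓ → Walk G v u ℓ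
reverse E-sym nil        = nil
reverse E-sym (cons e p) = snoc (reverse E-sym p) (E-sym e)

Dist-unique : ∀ {G u v d d′} → Dist G u v d → Dist G u v d′ → d ≡ d′
Dist-unique {d = d} {d′} (w , min) (w′ , min′) with ℕP.<-cmp d d′
... | tri< d<d′ _ _ = ⊥-elim (min′ d d<d′ w)
... | tri≈ _ d≡d′ _ = d≡d′
... | tri> _ _ d>d′ = ⊥-elim (min d′ d>d′ w′)

Dist-refl : ∀ {G} u → Dist G u u 0
Dist-refl u = nil , λ _ ()

Dist-zero : ∀ {G u v} → Dist G u v 0 → u ≡ v
Dist-zero (nil , _) = refl

record EdgeMetric (G : Graph) : Set where
  field
    δ      : V G → V G → ℕ
    δ-refl : ∀ u → δ u u ≡ 0
    δ-tri  : ∀ u w v → δ u v ≤ δ u w + δ w v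
    δ-edge : ∀ {u v} → E G u v → δ u v ≡ 1

module _ {G : Graph} (M : EdgeMetric G) where
  open EdgeMetric M

  -- Each step of a walk increases δ by at most one.
  walk-bound : ∀ {u v ℓ} → Walk G u v ℓ → δ u v ≤ ℓ
  walk-bound {u} nil = ℕP.≤-reflexive (δ-refl u)
  walk-bound {u} {v} (cons {w = w} e p) = begin
    δ u v         ≤⟨ δ-tri u w v ⟩
    δ u w + δ w v ≡⟨ cong (_+ δ w v) (δ-edge e) ⟩
    suc (δ w v)   ≤⟨ s≤s (walk-bound p) ⟩
    suc _         ∎
    where open ℕP.≤-Reasoning

  geodesic-Dist : ∀ {u v n} → δ u v ≡ n → Walk G u v n → Dist G u v n
  geodesic-Dist δ≡n w = w , λ ℓ ℓ<n w′ → ℕP.<⇒≱ ℓ<n (subst (_≤ ℓ) δ≡n (walk-bound w′))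

-- A map realising, in H, the distances δ of G is an isometric embedding;
-- injectivity follows since distance 0 is reflected.
isometric-by-distances : ∀ {G H} (g : V G → V H) (δ : V G → V G → ℕ) →
  (∀ u v → Dist G u v (δ u v)) → (∀ u v → Dist H (g u) (g v) (δ u v)) → IsIsometric G H g
isometric-by-distances {G} {H} g δ distG distH = injective , λ u v d → preserve u v d , reflect u v d
  where
  preserve : ∀ u v d → Dist G u v d → Dist H (g u) (g v) d
  preserve u v d D = subst (Dist H (g u) (g v)) (Dist-unique (distG u v) D) (distH u v)
  reflect : ∀ u v d → Dist H (g u) (g v) d → Dist G u v d
  reflect u v d D = subst (Dist G u v) (Dist-unique (distH u v) D) (distG u v)
  injective : ∀ {u v} → g u ≡ g v → u ≡ v
  injective {u} {v} gu≡gv = Dist-zero (reflect u v 0 (subst (λ t → Dist H (g u) t 0) gu≡gv (Dist-refl (g u))))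

isometric-∘ : ∀ {G H K} {g : V G → V H} {h : V H → V K} →
  IsIsometric G H g → IsIsometric H K h → IsIsometric G K (h ∘ g)
isometric-∘ {g = g} (g-inj , g-iso) (h-inj , h-iso) =
  g-inj ∘ h-inj ,
  λ u v d → proj₁ (h-iso (g u) (g v) d) ∘ proj₁ (g-iso u v d) ,
            proj₂ (g-iso u v d) ∘ proj₂ (h-iso (g u) (g v) d)

L1-refl : ∀ {ℓ} (x : Vec ℤ ℓ) → L1 x x ≡ 0
L1-refl []      = refl
L1-refl (a ∷ x) rewrite ℤP.+-inverseʳ a = L1-refl x

L1-sym : ∀ {ℓ} (x y : Vec ℤ ℓ) → L1 x y ≡ L1 y x
L1-sym []      []      = refl
L1-sym (a ∷ x) (b ∷ y) = cong₂ _+_ (ℤP.∣i-j∣≡∣j-i∣ a b) (L1-sym x y)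

∣-∣-tri : ∀ (a b c : ℤ) → ∣ a - c ∣ ≤ ∣ a - b ∣ + ∣ b - c ∣
∣-∣-tri a b c = subst (λ t → ∣ t ∣ ≤ ∣ a - b ∣ + ∣ b - c ∣) (telescope a b c) (ℤP.∣i+j∣≤∣i∣+∣j∣ (a - b) (b - c))
  where
  telescope : ∀ a b c → (a - b) ℤ.+ (b - c) ≡ a - c
  telescope = ℤSolver.solve-∀

L1-tri : ∀ {ℓ} (x y z : Vec ℤ ℓ) → L1 x z ≤ L1 x y + L1 y z
L1-tri []      []      []      = z≤n
L1-tri (a ∷ x) (b ∷ y) (c ∷ z) = begin
  ∣ a - c ∣ + L1 x z                             ≤⟨ ℕP.+-mono-≤ (∣-∣-tri a b c) (L1-tri x y z) ⟩
  (∣ a - b ∣ + ∣ b - c ∣) + (L1 x y + L1 y z)   ≡⟨ interchange ∣ a - b ∣ ∣ b - c ∣ (L1 x y) (L1 y z) ⟩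
  (∣ a - b ∣ + L1 x y) + (∣ b - c ∣ + L1 y z)   ∎
  where
  open ℕP.≤-Reasoning
  interchange : ∀ p q r s → (p + q) + (r + s) ≡ (p + r) + (q + s)
  interchange = ℕSolver.solve-∀

L1-metric : ∀ ℓ → EdgeMetric (Zℓ ℓ)
L1-metric ℓ = record { δ = L1 ; δ-refl = L1-refl ; δ-tri = L1-tri ; δ-edge = λ e → e }

bit : Bool → ℤ
bit true  = + 1
bit false = + 0

hamming≡L1 : ∀ {d} (x y : Vec Bool d) → hamming x y ≡ L1 (map bit x) (map bit y)
hamming≡L1 []          []          = refl
hamming≡L1 (true ∷ x)  (true ∷ y)  = hamming≡L1 x y
hamming≡L1 (true ∷ x)  (false ∷ y) = cong suc (hamming≡L1 x y)
hamming≡L1 (false ∷ x) (true ∷ y)  = cong suc (hamming≡L1 x y)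
hamming≡L1 (false ∷ x) (false ∷ y) = hamming≡L1 x y

hamming-refl : ∀ {d} (x : Vec Bool d) → hamming x x ≡ 0
hamming-refl x = trans (hamming≡L1 x x) (L1-refl (map bit x))

hamming-sym : ∀ {d} (x y : Vec Bool d) → hamming x y ≡ hamming y x
hamming-sym x y rewrite hamming≡L1 x y | hamming≡L1 y x = L1-sym (map bit x) (map bit y)

hamming-tri : ∀ {d} (x y z : Vec Bool d) → hamming x z ≤ hamming x y + hamming y z
hamming-tri x y z rewrite hamming≡L1 x z | hamming≡L1 x y | hamming≡L1 y z =
  L1-tri (map bit x) (map bit y) (map bit z)

hamming-++ : ∀ {m n} (x x′ : Vec Bool m) (y y′ : Vec Bool n) →
  hamming (x ++ y) (x′ ++ y′) ≡ hamming x x′ + hamming y y′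
hamming-++ []          []           y y′ = refl
hamming-++ (true ∷ x)  (true ∷ x′)  y y′ = hamming-++ x x′ y y′
hamming-++ (true ∷ x)  (false ∷ x′) y y′ = cong suc (hamming-++ x x′ y y′)
hamming-++ (false ∷ x) (true ∷ x′)  y y′ = cong suc (hamming-++ x x′ y y′)
hamming-++ (false ∷ x) (false ∷ x′) y y′ = hamming-++ x x′ y y′

hamming-metric : ∀ d → EdgeMetric (Γ d)
hamming-metric d = record
  { δ      = λ u v → hamming (proj₁ u) (proj₁ v)
  ; δ-refl = λ u → hamming-refl (proj₁ u)
  ; δ-tri  = λ u w v → hamming-tri (proj₁ u) (proj₁ w) (proj₁ v)
  ; δ-edge = λ e → e
  }

-- Being a Fibonacci string is a proposition, so vertices of Γ_d are
-- determined by their strings.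
fib-irrelevant : ∀ {d} {x : Vec Bool d} (p q : Fib x) → p ≡ q
fib-irrelevant fib[]      fib[]       = refl
fib-irrelevant (fib1 b)   (fib1 .b)   = refl
fib-irrelevant (fib0∷ p)  (fib0∷ q)   = cong fib0∷ (fib-irrelevant p q)
fib-irrelevant (fib10∷ p) (fib10∷ q)  = cong fib10∷ (fib-irrelevant p q)

retarget : ∀ {d x y ℓ} {p q p′ q′} → Walk (Γ d) (x , p) (y , q) ℓ → Walk (Γ d) (x , p′) (y , q′) ℓ
retarget {p = p} {q} {p′} {q′} w rewrite fib-irrelevant p′ p | fib-irrelevant q′ q = w

stay : ∀ {d x} (p q : Fib {d} x) → Walk (Γ d) (x , p) (x , q) 0
stay p q rewrite fib-irrelevant q p = nil

fib-0∷ : ∀ {d} {x : Vec Bool d} → Fib x → Fib (false ∷ x)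
fib-0∷ {x = []}    _ = fib1 false
fib-0∷ {x = b ∷ x} p = fib0∷ p

fib-tail : ∀ {d b} {x : Vec Bool d} → Fib (b ∷ x) → Fib x
fib-tail (fib1 b)   = fib[]
fib-tail (fib0∷ p)  = p
fib-tail (fib10∷ p) = p

data _⊑_ : ∀ {d} → Vec Bool d → Vec Bool d → Set where
  []   : [] ⊑ []
  keep : ∀ {d} b {z x : Vec Bool d} → z ⊑ x → (b ∷ z) ⊑ (b ∷ x)
  drop : ∀ {d} {z x : Vec Bool d} → z ⊑ x → (false ∷ z) ⊑ (true ∷ x)

fib-⊑ : ∀ {d} {z x : Vec Bool d} → z ⊑ x → Fib x → Fib z
fib-⊑ []                         fib[]        = fib[]
fib-⊑ (keep b [])                (fib1 .b)    = fib1 b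
fib-⊑ (drop [])                  (fib1 .true) = fib1 false
fib-⊑ (keep false s)             (fib0∷ p)    = fib-0∷ (fib-⊑ s p)
fib-⊑ (keep true (keep false s)) (fib10∷ p)   = fib10∷ (fib-0∷ (fib-⊑ s (fib-tail p)))
fib-⊑ (drop s)                   (fib10∷ p)   = fib-0∷ (fib-⊑ s p)

prepend0 : ∀ {d} → V (Γ d) → V (Γ (suc d))
prepend0 (x , p) = false ∷ x , fib-0∷ p

prepend10 : ∀ {d} → V (Γ d) → V (Γ (suc (suc d)))
prepend10 (x , p) = true ∷ false ∷ x , fib10∷ (fib-0∷ p)

-- From x one reaches any z ⊑ x inside Γ_d by switching off the extra 1s one
-- at a time; every intermediate string lies below x, hence is Fibonacci.
descend : ∀ {d} {x z : Vec Bool d} (fx : Fib x) (fz : Fib z) → z ⊑ x →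
          Walk (Γ d) (x , fx) (z , fz) (hamming x z)
descend fib[]          fz []                    = stay _ _
descend (fib1 true)    fz (keep .true [])       = stay _ _
descend (fib1 false)   fz (keep .false [])      = stay _ _
descend (fib1 .true)   fz (drop [])             = cons {w = false ∷ [] , fz} refl nil
descend (fib0∷ p)      fz (keep false s)        =
  retarget (mapWalk prepend0 (λ e → e) (descend p (fib-⊑ s p) s))
descend (fib10∷ p)     fz (keep true (keep false s)) =
  retarget (mapWalk prepend10 (λ e → e) (descend (fib-tail p) (fib-⊑ s (fib-tail p)) s))
descend (fib10∷ {xs = xs} p) fz (drop (keep false s)) =
  cons {w = false ∷ false ∷ xs , fib-0∷ p} (cong suc (hamming-refl xs))
    (retarget (mapWalk prepend0 (λ e → e) (descend p (fib-0∷ (fib-⊑ s (fib-tail p))) (keep false s))))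

meet : ∀ {d} → Vec Bool d → Vec Bool d → Vec Bool d
meet = zipWith _∧_

meet-⊑ˡ : ∀ {d} (x y : Vec Bool d) → meet x y ⊑ x
meet-⊑ˡ []          []          = []
meet-⊑ˡ (true ∷ x)  (true ∷ y)  = keep true (meet-⊑ˡ x y)
meet-⊑ˡ (true ∷ x)  (false ∷ y) = drop (meet-⊑ˡ x y)
meet-⊑ˡ (false ∷ x) (_ ∷ y)     = keep false (meet-⊑ˡ x y)

meet-⊑ʳ : ∀ {d} (x y : Vec Bool d) → meet x y ⊑ y
meet-⊑ʳ []          []          = []
meet-⊑ʳ (true ∷ x)  (true ∷ y)  = keep true (meet-⊑ʳ x y)
meet-⊑ʳ (true ∷ x)  (false ∷ y) = keep false (meet-⊑ʳ x y)
meet-⊑ʳ (false ∷ x) (true ∷ y)  = drop (meet-⊑ʳ x y)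
meet-⊑ʳ (false ∷ x) (false ∷ y) = keep false (meet-⊑ʳ x y)

meet-hamming : ∀ {d} (x y : Vec Bool d) → hamming x (meet x y) + hamming y (meet x y) ≡ hamming x y
meet-hamming []          []          = refl
meet-hamming (true ∷ x)  (true ∷ y)  = meet-hamming x y
meet-hamming (true ∷ x)  (false ∷ y) = cong suc (meet-hamming x y)
meet-hamming (false ∷ x) (true ∷ y)  = trans (ℕP.+-suc _ _) (cong suc (meet-hamming x y))
meet-hamming (false ∷ x) (false ∷ y) = meet-hamming x y

Γ-edge-sym : ∀ {d} {u v : V (Γ d)} → E (Γ d) u v → E (Γ d) v u
Γ-edge-sym {u = u} {v} e = trans (hamming-sym (proj₁ v) (proj₁ u)) e

-- A walk of Hamming length: down from x to the meet, then up to y.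
Γ-path : ∀ {d} (u v : V (Γ d)) → Walk (Γ d) u v (hamming (proj₁ u) (proj₁ v))
Γ-path (x , fx) (y , fy) =
  subst (Walk _ _ _) (meet-hamming x y)
    (append (descend fx fm (meet-⊑ˡ x y)) (reverse (λ {u} {v} → Γ-edge-sym {u = u} {v}) (descend fy fm (meet-⊑ʳ x y))))
  where fm = fib-⊑ (meet-⊑ˡ x y) fx

Γ-Dist : ∀ {d} (u v : V (Γ d)) → Dist (Γ d) u v (hamming (proj₁ u) (proj₁ v))
Γ-Dist {d} u v = geodesic-Dist (hamming-metric d) refl (Γ-path u v)

-- Blocks of two bits: 10 ↦ -1, 00 ↦ 0, 01 ↦ 1 (the forbidden block 11 ↦ 0).
block : Bool → Bool → ℤ
block true  false = -[1+ 0 ]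
block false true  = + 1
block _     _     = + 0

fold : ∀ {d} → Vec Bool d → Vec ℤ ⌈ d /2⌉
fold []           = []
fold (a ∷ [])     = block a false ∷ []
fold (a ∷ b ∷ xs) = block a b ∷ fold xs

block-dist : ∀ {a b c d} → Fib (a ∷ b ∷ []) → Fib (c ∷ d ∷ []) →
  ∣ block a b - block c d ∣ ≡ hamming (a ∷ b ∷ []) (c ∷ d ∷ [])
block-dist (fib0∷ (fib1 false)) (fib0∷ (fib1 false)) = refl
block-dist (fib0∷ (fib1 false)) (fib0∷ (fib1 true))  = refl
block-dist (fib0∷ (fib1 false)) (fib10∷ _)           = refl
block-dist (fib0∷ (fib1 true))  (fib0∷ (fib1 false)) = refl
block-dist (fib0∷ (fib1 true))  (fib0∷ (fib1 true))  = refl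
block-dist (fib0∷ (fib1 true))  (fib10∷ _)           = refl
block-dist (fib10∷ _)           (fib0∷ (fib1 false)) = refl
block-dist (fib10∷ _)           (fib0∷ (fib1 true))  = refl
block-dist (fib10∷ _)           (fib10∷ _)           = refl

fib-head-block : ∀ {d a b} {x : Vec Bool d} → Fib (a ∷ b ∷ x) → Fib (a ∷ b ∷ [])
fib-head-block (fib0∷ {b = b} _) = fib0∷ (fib1 b)
fib-head-block (fib10∷ _)        = fib10∷ (fib1 false)

fold-L1 : ∀ {d} {x y : Vec Bool d} → Fib x → Fib y → L1 (fold x) (fold y) ≡ hamming x y
fold-L1 {x = []}         {[]}         _ _ = refl
fold-L1 {x = true ∷ []}  {true ∷ []}  _ _ = refl
fold-L1 {x = true ∷ []}  {false ∷ []} _ _ = refl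
fold-L1 {x = false ∷ []} {true ∷ []}  _ _ = refl
fold-L1 {x = false ∷ []} {false ∷ []} _ _ = refl
fold-L1 {x = a ∷ b ∷ xs} {c ∷ d ∷ ys} p q = begin
  ∣ block a b - block c d ∣ + L1 (fold xs) (fold ys)
    ≡⟨ cong₂ _+_ (block-dist (fib-head-block p) (fib-head-block q))
                 (fold-L1 (fib-tail (fib-tail p)) (fib-tail (fib-tail q))) ⟩
  hamming (a ∷ b ∷ []) (c ∷ d ∷ []) + hamming xs ys
    ≡⟨ sym (hamming-++ (a ∷ b ∷ []) (c ∷ d ∷ []) xs ys) ⟩
  hamming (a ∷ b ∷ xs) (c ∷ d ∷ ys) ∎
  where open ≡-Reasoning

foldΓ : ∀ {d} → V (Γ d) → V (Zℓ ⌈ d /2⌉)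
foldΓ (x , _) = fold x

fold-Dist : ∀ {d} (u v : V (Γ d)) → Dist (Zℓ ⌈ d /2⌉) (foldΓ u) (foldΓ v) (hamming (proj₁ u) (proj₁ v))
fold-Dist {d} u v =
  geodesic-Dist (L1-metric ⌈ d /2⌉) (fold-L1 (proj₂ u) (proj₂ v))
    (mapWalk foldΓ (λ {a} {b} e → trans (fold-L1 (proj₂ a) (proj₂ b)) e) (Γ-path u v))

fold-isometric : ∀ d → IsIsometric (Γ d) (Zℓ ⌈ d /2⌉) foldΓ
fold-isometric d = isometric-by-distances foldΓ (λ u v → hamming (proj₁ u) (proj₁ v)) Γ-Dist fold-Dist

proposition3p8 : (G : FinGraph) → IsPartialCube G →
    ∀ f l → IsFdim G f → IsLdim G l → l ≤ ⌈ f /2⌉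
proposition3p8 G _ f l ((g , g-isometric) , _) (_ , ldim-minimal) =
  ldim-minimal ⌈ f /2⌉ (foldΓ ∘ g , isometric-∘ g-isometric (fold-isometric f))
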